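{- Let $\mathbf{K}$ be an infinite structure, let $\mathbf{A}\le\mathbf{B}\in\mathrm{Age}(\mathbf{K})$, and suppose there is $f\in\mathrm{Emb}(\mathbf{A},\mathbf{B})$ such that the set $\mathrm{Emb}(\mathbf{B},\mathbf{K})\circ f=\{x\circ f: x\in\mathrm{Emb}(\mathbf{B},\mathbf{K})\}\subseteq\mathrm{Emb}(\mathbf{A},\mathbf{K})$ is large. Then $\mathrm{BRD}(\mathbf{A},\mathbf{K})\le\mathrm{BRD}(\mathbf{B},\mathbf{K})$.
   Context: Fix a relational language $\mathbb{L}$: a set of relation symbols $R$, each with an arity $n_R\ge 1$. A structure $\mathbf{A}$ consists of a set $A$ and subsets $R^{\mathbf{A}}\subseteq A^{n_R}$ for $R\in\mathbb{L}$. An embedding $f:\mathbf{A}\to\mathbf{B}$ is an injection $f:A\to B$ such that for every $R\in\mathbb{L}$ of arity $n$ and every $(a_0,\dots,a_{n-1})\in A^n$, $(a_0,\dots,a_{n-1})\in R^{\mathbf{A}}$ iff $(f(a_0),\dots,f(a_{n-1}))\in R^{\mathbf{B}}$. $\mathrm{Emb}(\mathbf{A},\mathbf{B})$ is the set of embeddings and $\mathrm{Emb}(\mathbf{K})=\mathrm{Emb}(\mathbf{K},\mathbf{K})$; $\mathbf{A}\le\mathbf{B}$ means $\mathrm{Emb}(\mathbf{A},\mathbf{B})\neq\emptyset$; $\mathrm{Age}(\mathbf{K})$ is the class of finite structures $\mathbf{A}\le\mathbf{K}$. A natural number $r$ is identified with $\{0,\dots,r-1\}$. For an infinite structure $\mathbf{K}$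 and $\mathbf{A}\in\mathrm{Age}(\mathbf{K})$, the big Ramsey degree $\mathrm{BRD}(\mathbf{A},\mathbf{K})$ is the least $t<\omega$ such that for every $r<\omega$ and every coloring $\chi:\mathrm{Emb}(\mathbf{A},\mathbf{K})\to r$ there is $g\in\mathrm{Emb}(\mathbf{K})$ with $|\chi[g\circ\mathrm{Emb}(\mathbf{A},\mathbf{K})]|\le t$; if no such $t$ exists, $\mathrm{BRD}(\mathbf{A},\mathbf{K})=\infty$. A set $S\subseteq\mathrm{Emb}(\mathbf{A},\mathbf{K})$ is large if there is $\eta\in\mathrm{Emb}(\mathbf{K})$ with $\eta\circ h\in S$ for every $h\in\mathrm{Emb}(\mathbf{A},\mathbf{K})$. -}

module Defs where

open import Data.Nat using (ℕ; _≤_; _<_)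
open import Data.Fin using (Fin)
open import Data.Product using (Σ; ∃; ∃-syntax; _×_; _,_; proj₁)
open import Data.Maybe using (Maybe; just; nothing)
open import Data.Unit using (⊤)
open import Data.Empty using (⊥)
open import Relation.Nullary using (¬_)
open import Relation.Binary.PropositionalEquality using (_≡_)
open import Function using (_∘_; id)
open import Function.Bundles using (_↔_; _⇔_)
open import Function.Definitions using (Injective)

record Language : Set₁ where
  field
    Sym   : Set
    arity : Sym → ℕ
    arity≥1 : (R : Sym) → 1 ≤ arity R
open Language public

record Structure (L : Language) : Set₁ where
  field
    Carrier : Set
    rel     : (R : Sym L) → (Fin (arity L R) → Carrier) → Set
open Structure public

-- ℕ ∪ {∞} as Maybe ℕ (nothing = ∞).
ℕ∞ : Set
ℕ∞ = Maybe ℕ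

_≤∞_ : ℕ∞ → ℕ∞ → Set
just m  ≤∞ just n  = m ≤ n
_       ≤∞ nothing = ⊤
nothing ≤∞ just _  = ⊥

module _ {L : Language} where

  IsEmbedding : (A B : Structure L) → (Carrier A → Carrier B) → Set
  IsEmbedding A B f =
    Injective _≡_ _≡_ f ×
    ((R : Sym L) (a : Fin (arity L R) → Carrier A) → (rel A R a ⇔ rel B R (f ∘ a)))

  Emb : (A B : Structure L) → Set
  Emb A B = Σ (Carrier A → Carrier B) (IsEmbedding A B)

  ⟦_⟧ : {A B : Structure L} → Emb A B → Carrier A → Carrier B
  ⟦ e ⟧ = proj₁ e

  _≈E_ : {A B : Structure L} → Emb A B → Emb A B → Set
  _≈E_ {A} e e′ = (a : Carrier A) → proj₁ e a ≡ proj₁ e′ a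

  comp : (A B C : Structure L) → Emb B C → Emb A B → Emb A C
  comp A B C (g , gi , gr) (f , fi , fr) =
    (g ∘ f) , (λ {x} {y} eq → fi (gi eq)) , λ R a → record
      { to   = λ p → Function.Bundles.Equivalence.to (gr R (f ∘ a)) (Function.Bundles.Equivalence.to (fr R a) p)
      ; from = λ p → Function.Bundles.Equivalence.from (fr R a) (Function.Bundles.Equivalence.from (gr R (f ∘ a)) p)
      ; to-cong = λ { _≡_.refl → _≡_.refl }
      ; from-cong = λ { _≡_.refl → _≡_.refl } }

  _≤S_ : Structure L → Structure L → Set
  A ≤S B = Emb A B

  IsFinite : Structure L → Set
  IsFinite A = Σ ℕ λ n → Carrier A ↔ Fin n

  IsInfinite : Structure L → Set
  IsInfinite A = ¬ IsFinite A

  InAge : Structure L → Structure L → Set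
  InAge A K = IsFinite A × (A ≤S K)

  -- An r-coloring of Emb(A,K): a map to r = Fin r which is a function on the
  -- SET of embeddings, i.e. depends only on the underlying map.
  Coloring : (A K : Structure L) → ℕ → Set
  Coloring A K r =
    Σ (Emb A K → Fin r) λ χ → (e e′ : Emb A K) → _≈E_ {A} {K} e e′ → χ e ≡ χ e′

  -- |χ[g ∘ Emb(A,K)]| ≤ t : the colours attained are covered by t colours.
  ImageBoundedBy : {A K : Structure L} {r : ℕ} → Coloring A K r → Emb K K → ℕ → Set
  ImageBoundedBy {A} {K} {r} (χ , _) g t =
    Σ (Fin t → Fin r) λ c → (h : Emb A K) → ∃[ i ] (χ (comp A K K g h) ≡ c i)

  BRDBound : (A K : Structure L) → ℕ → Set
  BRDBound A K t =
    (r : ℕ) (χ : Coloring A K r) → Σ (Emb K K) λ g → ImageBoundedBy χ g t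

  IsBRD : (A K : Structure L) → ℕ∞ → Set
  IsBRD A K (just t) = BRDBound A K t × ((s : ℕ) → s < t → ¬ BRDBound A K s)
  IsBRD A K nothing  = (t : ℕ) → ¬ BRDBound A K t

  Large : (A K : Structure L) → (Emb A K → Set) → Set
  Large A K S = Σ (Emb K K) λ η → (h : Emb A K) → S (comp A K K η h)

  InCompImage : {A B K : Structure L} → Emb A B → Emb A K → Set
  InCompImage {A} {B} {K} f e = Σ (Emb B K) λ x → _≈E_ {A} {K} (comp A B K x f) e

{-# OPTIONS --safe #-}
module Submission where

-- Colour each copy x of B by the colour of its copy x ∘ f of A. A bound g
-- for this colouring, composed with the witness η of largeness, bounds the
-- original colouring: every η ∘ h equals some x ∘ f, so g ∘ η ∘ h = (g ∘ x) ∘ f.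

open import Defs
open import Data.Nat using (ℕ)
open import Data.Nat.Properties using (≮⇒≥)
open import Data.Fin using (Fin)
open import Data.Product using (_,_; proj₁; Σ-syntax)
open import Data.Maybe using (just; nothing)
open import Data.Unit using (tt)
open import Relation.Binary.PropositionalEquality using (_≡_; sym; trans; cong)

module _ {L : Language} {A B K : Structure L} where

  precomposeColoring : {r : ℕ} → Emb A B → Coloring A K r → Coloring B K r
  precomposeColoring f (χ , χ-resp) =
    (λ x → χ (comp A B K x f)) , (λ x x′ x≈x′ → χ-resp _ _ (λ a → x≈x′ (proj₁ f a)))

  BRDBound-fromLargeImage : (f : Emb A B) → Large A K (InCompImage {A = A} {B = B} {K = K} f) →
                            (t : ℕ) → BRDBound B K t → BRDBound A K t
  BRDBound-fromLargeImage f (η , η∘h∈image) t boundB r χ@(χ₀ , χ-resp)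
    with boundB r (precomposeColoring f χ)
  ... | g , c , g-bounded = comp K K K g η , c , bounded
    where
      bounded : (h : Emb A K) → Σ[ i ∈ Fin t ] (χ₀ (comp A K K (comp K K K g η) h) ≡ c i)
      bounded h with η∘h∈image h
      ... | x , x∘f≈η∘h with g-bounded x
      ... | i , χ[g∘x∘f]≡cᵢ =
        i , trans (χ-resp _ _ (λ a → cong (proj₁ g) (sym (x∘f≈η∘h a)))) χ[g∘x∘f]≡cᵢ

module _ {L : Language} {A K A′ K′ : Structure L} where

  IsBRD-mono : ((t : ℕ) → BRDBound A′ K′ t → BRDBound A K t) →
               (d d′ : ℕ∞) → IsBRD A K d → IsBRD A′ K′ d′ → d ≤∞ d′
  IsBRD-mono _        (just _) nothing  _             _            = tt
  IsBRD-mono _        nothing  nothing  _             _            = tt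
  IsBRD-mono transfer nothing  (just t) noBound       (bound′ , _) = noBound t (transfer t bound′)
  IsBRD-mono transfer (just s) (just t) (_ , minimal) (bound′ , _) =
    ≮⇒≥ (λ t<s → minimal t t<s (transfer t bound′))

proposition2p3 : {L : Language} (K A B : Structure L) →
    IsInfinite K → InAge A K → InAge B K → A ≤S B →
    (f : Emb A B) → Large A K (InCompImage {A = A} {B = B} {K = K} f) →
    (dA dB : ℕ∞) → IsBRD A K dA → IsBRD B K dB → dA ≤∞ dB
proposition2p3 K A B _ _ _ _ f large =
  IsBRD-mono (BRDBound-fromLargeImage f large)
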